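{- Let $G$ be an orientation of a chordal graph with no induced copy of $\vec{C}_3\Rightarrow K_1$, and let $T$ be a transitive subtournament of $G$ on vertices $v_1,\dots,v_n$ such that $v_iv_j$ is an arc for all $1\le i<j\le n$. Then for every $j\in\{1,\dots,n-1\}$, the digraph $F$ obtained from $G$ by adding a new vertex $x$ together with the arcs $xv_i$ for $1\le i\le j$ and $v_ix$ for $j+1\le i\le n$ is an orientation of a chordal graph with no induced copy of $\vec{C}_3\Rightarrow K_1$.
   Context: All digraphs are finite and simple (no loops, no parallel arcs, no digons). An orientation of a chordal graph is a digraph whose underlying undirected graph has no induced cycle of length at least $4$. A transitive subtournament is a set of pairwise adjacent vertices inducing an acyclic subdigraph. $\vec{C}_3$ is the directed cycle on three vertices; $\vec{C}_3\Rightarrow K_1$ is the digraph consisting of a directed triangle together with a fourth vertex that is an out-neighbour of all three triangle vertices. -}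

module Defs where

open import Data.Nat using (ℕ; zero; suc; _≤_; _<_)
open import Data.Fin as Fin using (Fin; toℕ)
open import Data.Bool using (Bool; true; false; T)
open import Data.Product using (Σ; ∃; _×_; _,_)
open import Data.Sum using (_⊎_)
open import Data.Empty using (⊥)
open import Relation.Nullary using (¬_)
open import Relation.Binary.PropositionalEquality using (_≡_)
open import Function.Definitions using (Injective)
open import Function.Bundles using (_⇔_)

record Digraph : Set₁ where
  field
    size : ℕ
    arc  : Fin size → Fin size → Set
open Digraph public

-- Simple digraph with no digons: no loops, no pair of opposite arcs.
-- (Parallel arcs cannot occur since arcs form a relation.)
IsOriented : Digraph → Set
IsOriented G = (∀ v → ¬ arc G v v) × (∀ u v → arc G u v → ¬ arc G v u)

Adj : (G : Digraph) → Fin (size G) → Fin (size G) → Set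
Adj G u v = arc G u v ⊎ arc G v u

CycAdjacent : (k : ℕ) → Fin k → Fin k → Set
CycAdjacent k i i' =
    (suc (toℕ i) ≡ toℕ i') ⊎ (suc (toℕ i') ≡ toℕ i)
  ⊎ ((toℕ i ≡ 0) × (suc (toℕ i') ≡ k)) ⊎ ((toℕ i' ≡ 0) × (suc (toℕ i) ≡ k))

InducedCycle : (G : Digraph) → (k : ℕ) → (Fin k → Fin (size G)) → Set
InducedCycle G k c =
  Injective _≡_ _≡_ c × (∀ i i' → Adj G (c i) (c i') ⇔ CycAdjacent k i i')

IsChordal : Digraph → Set
IsChordal G = ∀ (k : ℕ) → 4 ≤ k → (c : Fin k → Fin (size G)) → ¬ InducedCycle G k c

-- Arc table of C⃗₃ ⇒ K₁ on vertices 0,1,2,3: triangle 0→1→2→0 and i→3 for i<3.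
C3⇒K1-arc : Fin 4 → Fin 4 → Bool
C3⇒K1-arc Fin.zero (Fin.suc Fin.zero) = true
C3⇒K1-arc (Fin.suc Fin.zero) (Fin.suc (Fin.suc Fin.zero)) = true
C3⇒K1-arc (Fin.suc (Fin.suc Fin.zero)) Fin.zero = true
C3⇒K1-arc Fin.zero (Fin.suc (Fin.suc (Fin.suc Fin.zero))) = true
C3⇒K1-arc (Fin.suc Fin.zero) (Fin.suc (Fin.suc (Fin.suc Fin.zero))) = true
C3⇒K1-arc (Fin.suc (Fin.suc Fin.zero)) (Fin.suc (Fin.suc (Fin.suc Fin.zero))) = true
C3⇒K1-arc _ _ = false

InducedC3⇒K1 : (G : Digraph) → (Fin 4 → Fin (size G)) → Set
InducedC3⇒K1 G φ =
  Injective _≡_ _≡_ φ × (∀ a b → arc G (φ a) (φ b) ⇔ T (C3⇒K1-arc a b))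

C3⇒K1-free : Digraph → Set
C3⇒K1-free G = ∀ (φ : Fin 4 → Fin (size G)) → ¬ InducedC3⇒K1 G φ

Good : Digraph → Set
Good G = IsOriented G × IsChordal G × C3⇒K1-free G

-- A transitive subtournament v_1,…,v_m (here t 0,…,t (m-1)), distinct, with
-- v_i v_j an arc whenever i < j.
IsOrderedTransTournament : (G : Digraph) → (m : ℕ) → (Fin m → Fin (size G)) → Set
IsOrderedTransTournament G m t =
  Injective _≡_ _≡_ t × (∀ (i i' : Fin m) → i Fin.< i' → arc G (t i) (t i'))

-- F: add a new vertex x (= Fin.zero; old vertex v becomes Fin.suc v) with arcs
-- x v_i for 1 ≤ i ≤ j (0-based: toℕ i < j) and v_i x for j+1 ≤ i ≤ m.
extend : (G : Digraph) → (m : ℕ) → (Fin m → Fin (size G)) → ℕ → Digraph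
extend G m t j = record { size = suc (size G) ; arc = arcF }
  where
  arcF : Fin (suc (size G)) → Fin (suc (size G)) → Set
  arcF Fin.zero Fin.zero = ⊥
  arcF Fin.zero (Fin.suc v) = Σ (Fin m) λ i → (toℕ i < j) × (t i ≡ v)
  arcF (Fin.suc u) Fin.zero = Σ (Fin m) λ i → (j ≤ toℕ i) × (t i ≡ u)
  arcF (Fin.suc u) (Fin.suc v) = arc G u v

{-# OPTIONS --safe #-}
-- The new vertex x is adjacent exactly to the vertices of the tournament, which
-- form a clique, so x is simplicial and lies on no induced cycle of length at
-- least 4; induced cycles avoiding x already live in G. In an induced copy of
-- C⃗₃ ⇒ K₁ through x, x is either a triangle vertex, hence the middle of a
-- transitive triple u → x → w, u → w, or the sink, with a directed triangle
-- among its in-neighbours. Both are impossible: arcs of the tournament go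
-- forward in its order, every out-neighbour of x precedes every in-neighbour
-- of x, and the tournament is acyclic.
module Submission where

open import Defs
open import Data.Nat using (ℕ; _≤_; _<_; zero; suc; z≤n; s≤s; _≟_)
open import Data.Nat.Properties as ℕ using (≤-refl; n<1+n; ≤∧≢⇒<; <-≤-trans; <⇒≱)
open import Data.Fin as Fin using (Fin; toℕ; fromℕ<; punchOut)
open import Data.Fin.Properties as Fin using (toℕ-fromℕ<; toℕ<n; <-cmp; any?; punchIn-punchOut)
open import Data.Bool using (T)
open import Data.Unit using (tt)
open import Data.Product using (Σ; ∃; ∃₂; _×_; _,_; proj₁; proj₂)
open import Data.Sum using (_⊎_; inj₁; inj₂)
open import Data.Empty using (⊥-elim)
open import Function using (_∘_)
open import Function.Definitions using (Injective)
open import Function.Bundles using (_⇔_; Equivalence)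
open import Relation.Nullary using (¬_; yes; no)
open import Relation.Binary using (tri<; tri≈; tri>)
open import Relation.Binary.PropositionalEquality
open Equivalence using (to; from)

pattern 0F = Fin.zero
pattern 1F = Fin.suc Fin.zero
pattern 2F = Fin.suc (Fin.suc Fin.zero)
pattern 3F = Fin.suc (Fin.suc (Fin.suc Fin.zero))

-- Induced copies: InducedCycle G k ≡ Embeds (Adj G) (CycAdjacent k) and
-- InducedC3⇒K1 G ≡ Embeds (arc G) (T ∘₂ C3⇒K1-arc), definitionally.
Embeds : {A B : Set} → (B → B → Set) → (A → A → Set) → (A → B) → Set
Embeds R S c = Injective _≡_ _≡_ c × (∀ a b → R (c a) (c b) ⇔ S a b)

Embeds-suc⁻ : ∀ {A : Set} {n} (R : Fin (suc n) → Fin (suc n) → Set) (S : A → A → Set)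
              {c : A → Fin (suc n)} {ψ : A → Fin n} →
              (∀ a → c a ≡ Fin.suc (ψ a)) → Embeds R S c →
              Embeds (λ u v → R (Fin.suc u) (Fin.suc v)) S ψ
Embeds-suc⁻ R S {c} {ψ} c≡sucψ (c-inj , c-iff) = ψ-inj , ψ-iff
  where
  open ≡-Reasoning
  ψ-inj : Injective _≡_ _≡_ ψ
  ψ-inj {a} {b} ψa≡ψb = c-inj (begin
    c a            ≡⟨ c≡sucψ a ⟩
    Fin.suc (ψ a)  ≡⟨ cong Fin.suc ψa≡ψb ⟩
    Fin.suc (ψ b)  ≡⟨ sym (c≡sucψ b) ⟩
    c b            ∎)
  ψ-iff : ∀ a b → R (Fin.suc (ψ a)) (Fin.suc (ψ b)) ⇔ S a b
  ψ-iff a b = subst₂ (λ u v → R u v ⇔ S a b) (c≡sucψ a) (c≡sucψ b) (c-iff a b)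

hits-zero-or-factors-through-suc : ∀ {k n} (c : Fin k → Fin (suc n)) →
  (∃ λ a → c a ≡ Fin.zero) ⊎ (Σ (Fin k → Fin n) λ ψ → ∀ a → c a ≡ Fin.suc (ψ a))
hits-zero-or-factors-through-suc c with any? (λ a → c a Fin.≟ Fin.zero)
... | yes hit = inj₁ hit
... | no miss = inj₂ ((λ a → punchOut (zero≢ a)) , λ a → sym (punchIn-punchOut (zero≢ a)))
  where
  zero≢ : ∀ a → Fin.zero ≢ c a
  zero≢ a 0≡ca = miss (a , sym 0≡ca)

CycAdjacentℕ : ℕ → ℕ → ℕ → Set
CycAdjacentℕ k r s =
    (suc r ≡ s) ⊎ (suc s ≡ r) ⊎ ((r ≡ 0) × (suc s ≡ k)) ⊎ ((s ≡ 0) × (suc r ≡ k))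

cycle-neighboursℕ : ∀ {k r} → 4 ≤ k → r < k →
  ∃₂ λ a b → a < k × b < k × CycAdjacentℕ k r a × CycAdjacentℕ k r b ×
             a ≢ b × ¬ CycAdjacentℕ k a b
cycle-neighboursℕ {r = zero} (s≤s (s≤s (s≤s (s≤s {n = k} _)))) _ =
  1 , suc (suc (suc k)) , s≤s (s≤s z≤n) , ≤-refl ,
  inj₁ refl , inj₂ (inj₂ (inj₁ (refl , refl))) , (λ ()) ,
  λ { (inj₁ ()) ; (inj₂ (inj₁ ())) ; (inj₂ (inj₂ (inj₁ (() , _)))) ; (inj₂ (inj₂ (inj₂ (() , _)))) }
cycle-neighboursℕ {k} {suc r} 4≤k r<k with suc (suc r) ≟ k
... | yes refl =
  r , 0 , ℕ.<-trans (n<1+n r) r<k , <-≤-trans (s≤s z≤n) 4≤k ,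
  inj₂ (inj₁ refl) , inj₂ (inj₂ (inj₂ (refl , refl))) , r≢0 4≤k , ¬last 4≤k
  where
  r≢0 : ∀ {r} → 4 ≤ suc (suc r) → r ≢ 0
  r≢0 (s≤s (s≤s ())) refl
  ¬last : ∀ {r} → 4 ≤ suc (suc r) → ¬ CycAdjacentℕ (suc (suc r)) r 0
  ¬last _ (inj₁ ())
  ¬last (s≤s (s≤s (s≤s ()))) (inj₂ (inj₁ refl))
  ¬last _ (inj₂ (inj₂ (inj₂ (_ , ()))))
... | no r+2≢k =
  r , suc (suc r) , ℕ.<-trans (n<1+n r) r<k , ≤∧≢⇒< r<k r+2≢k ,
  inj₂ (inj₁ refl) , inj₁ refl , (λ ()) , ¬skip 4≤k
  where
  ¬skip : ∀ {k r} → 4 ≤ k → ¬ CycAdjacentℕ k r (suc (suc r))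
  ¬skip _ (inj₁ ())
  ¬skip _ (inj₂ (inj₁ ()))
  ¬skip (s≤s (s≤s (s≤s ()))) (inj₂ (inj₂ (inj₁ (refl , refl))))
  ¬skip _ (inj₂ (inj₂ (inj₂ (() , _))))

cycle-neighbours : ∀ {k} → 4 ≤ k → (i : Fin k) →
  ∃₂ λ a b → CycAdjacent k i a × CycAdjacent k i b × a ≢ b × ¬ CycAdjacent k a b
cycle-neighbours {k} 4≤k i with cycle-neighboursℕ 4≤k (toℕ<n i)
... | a , b , a<k , b<k , ia , ib , a≢b , ¬ab =
  fromℕ< a<k , fromℕ< b<k ,
  subst (CycAdjacentℕ k (toℕ i)) (sym ≡a) ia ,
  subst (CycAdjacentℕ k (toℕ i)) (sym ≡b) ib ,
  (λ e → a≢b (trans (sym ≡a) (trans (cong toℕ e) ≡b))) ,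
  (λ adj → ¬ab (subst₂ (CycAdjacentℕ k) ≡a ≡b adj))
  where
  ≡a = toℕ-fromℕ< a<k
  ≡b = toℕ-fromℕ< b<k

Simplicial : (H : Digraph) → Fin (size H) → Set
Simplicial H v = ∀ u w → Adj H v u → Adj H v w → u ≢ w → Adj H u w

simplicial-avoids-long-induced-cycles : ∀ {H v k} {c : Fin k → Fin (size H)} →
  Simplicial H v → 4 ≤ k → InducedCycle H k c → ∀ i → c i ≢ v
simplicial-avoids-long-induced-cycles {c = c} simplicial 4≤k (c-inj , c-iff) i refl
  with cycle-neighbours 4≤k i
... | a , b , ia , ib , a≢b , ¬ab =
  ¬ab (to (c-iff a b) (simplicial (c a) (c b) (from (c-iff i a) ia) (from (c-iff i b) ib) (a≢b ∘ c-inj)))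

module _ {G : Digraph} {m} {t : Fin m → Fin (size G)} (tr : IsOrderedTransTournament G m t) where

  tournament-adj : ∀ {p q} → p ≢ q → Adj G (t p) (t q)
  tournament-adj {p} {q} p≢q with <-cmp p q
  ... | tri< p<q _ _ = inj₁ (proj₂ tr p q p<q)
  ... | tri≈ _ p≡q _ = ⊥-elim (p≢q p≡q)
  ... | tri> _ _ q<p = inj₂ (proj₂ tr q p q<p)

  tournament-arc⇒< : IsOriented G → ∀ {p q} → arc G (t p) (t q) → p Fin.< q
  tournament-arc⇒< (irrefl , asym) {p} {q} tp→tq with <-cmp p q
  ... | tri< p<q _ _ = p<q
  ... | tri≈ _ refl _ = ⊥-elim (irrefl (t p) tp→tq)
  ... | tri> _ _ q<p = ⊥-elim (asym (t p) (t q) tp→tq (proj₂ tr q p q<p))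

  tournament-no-directed-triangle : IsOriented G → ∀ {p q r} →
    arc G (t p) (t q) → arc G (t q) (t r) → ¬ arc G (t r) (t p)
  tournament-no-directed-triangle oG tp→tq tq→tr tr→tp =
    Fin.<-irrefl refl (Fin.<-trans (arc⇒< tp→tq) (Fin.<-trans (arc⇒< tq→tr) (arc⇒< tr→tp)))
    where
    arc⇒< = tournament-arc⇒< oG

  module Extension (j : ℕ) where

    F : Digraph
    F = extend G m t j

    x : Fin (size F)
    x = Fin.zero

    in-neighbour-of-x : ∀ u → arc F u x → ∃ λ p → j ≤ toℕ p × u ≡ Fin.suc (t p)
    in-neighbour-of-x (Fin.suc u) (p , j≤p , tp≡u) = p , j≤p , cong Fin.suc (sym tp≡u)

    out-neighbour-of-x : ∀ u → arc F x u → ∃ λ p → toℕ p < j × u ≡ Fin.suc (t p)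
    out-neighbour-of-x (Fin.suc u) (p , p<j , tp≡u) = p , p<j , cong Fin.suc (sym tp≡u)

    neighbour-of-x : ∀ u → Adj F x u → ∃ λ p → u ≡ Fin.suc (t p)
    neighbour-of-x u (inj₁ x→u) = let p , _ , u≡ = out-neighbour-of-x u x→u in p , u≡
    neighbour-of-x u (inj₂ u→x) = let p , _ , u≡ = in-neighbour-of-x u u→x in p , u≡

    extend-oriented : IsOriented G → IsOriented F
    extend-oriented (irrefl , asym) = irreflF , asymF
      where
      irreflF : ∀ v → ¬ arc F v v
      irreflF (Fin.suc v) = irrefl v
      no-digon-at-x : ∀ v → arc F x v → ¬ arc F v x
      no-digon-at-x v x→v v→x with out-neighbour-of-x v x→v | in-neighbour-of-x v v→x
      ... | p , p<j , refl | q , j≤q , tp≡tq with proj₁ tr (Fin.suc-injective tp≡tq)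
      ... | refl = <⇒≱ p<j j≤q
      asymF : ∀ u v → arc F u v → ¬ arc F v u
      asymF Fin.zero v = no-digon-at-x v
      asymF (Fin.suc u) Fin.zero u→x x→u = no-digon-at-x (Fin.suc u) x→u u→x
      asymF (Fin.suc u) (Fin.suc v) = asym u v

    x-simplicial : Simplicial F x
    x-simplicial u w x–u x–w u≢w with neighbour-of-x u x–u | neighbour-of-x w x–w
    ... | p , refl | q , refl = tournament-adj λ { refl → u≢w refl }

    extend-chordal : IsChordal G → IsChordal F
    extend-chordal chordal k 4≤k c cycle with hits-zero-or-factors-through-suc c
    ... | inj₁ (i , ci≡x) = simplicial-avoids-long-induced-cycles x-simplicial 4≤k cycle i ci≡x
    ... | inj₂ (ψ , c≡sucψ) = chordal k 4≤k ψ (Embeds-suc⁻ (Adj F) (CycAdjacent k) c≡sucψ cycle)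

    x-not-middle-of-transitive-triple : IsOriented G → ∀ u v w →
      arc F u v → arc F v w → arc F u w → v ≢ x
    x-not-middle-of-transitive-triple oG u _ w u→x x→w u→w refl
      with in-neighbour-of-x u u→x | out-neighbour-of-x w x→w
    ... | p , j≤p , refl | q , q<j , refl =
      <⇒≱ (ℕ.<-trans (tournament-arc⇒< oG u→w) q<j) j≤p

    x-not-sink-of-directed-triangle : IsOriented G → ∀ u v w s →
      arc F u v → arc F v w → arc F w u → arc F u s → arc F v s → arc F w s → s ≢ x
    x-not-sink-of-directed-triangle oG u v w _ u→v v→w w→u u→x v→x w→x refl
      with in-neighbour-of-x u u→x | in-neighbour-of-x v v→x | in-neighbour-of-x w w→x
    ... | _ , _ , refl | _ , _ , refl | _ , _ , refl = tournament-no-directed-triangle oG u→v v→w w→u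

    extend-C3⇒K1-free : IsOriented G → C3⇒K1-free G → C3⇒K1-free F
    extend-C3⇒K1-free oG free φ copy with hits-zero-or-factors-through-suc φ
    ... | inj₂ (ψ , φ≡sucψ) = free ψ (Embeds-suc⁻ (arc F) (λ a b → T (C3⇒K1-arc a b)) φ≡sucψ copy)
    ... | inj₁ (a , φa≡x) = x-not-in-copy a φa≡x
      where
      copy-arc : ∀ a b → T (C3⇒K1-arc a b) → arc F (φ a) (φ b)
      copy-arc a b = from (proj₂ copy a b)
      middle : ∀ a b c → T (C3⇒K1-arc a b) → T (C3⇒K1-arc b c) → T (C3⇒K1-arc a c) → φ b ≢ x
      middle a b c ab bc ac =
        x-not-middle-of-transitive-triple oG (φ a) (φ b) (φ c) (copy-arc a b ab) (copy-arc b c bc) (copy-arc a c ac)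
      x-not-in-copy : ∀ a → φ a ≢ x
      x-not-in-copy 0F = middle 2F 0F 3F tt tt tt
      x-not-in-copy 1F = middle 0F 1F 3F tt tt tt
      x-not-in-copy 2F = middle 1F 2F 3F tt tt tt
      x-not-in-copy 3F = x-not-sink-of-directed-triangle oG (φ 0F) (φ 1F) (φ 2F) (φ 3F)
        (copy-arc 0F 1F tt) (copy-arc 1F 2F tt) (copy-arc 2F 0F tt) (copy-arc 0F 3F tt) (copy-arc 1F 3F tt) (copy-arc 2F 3F tt)

lemma2p8 : (G : Digraph) → Good G →
           (m : ℕ) → (t : Fin m → Fin (size G)) → IsOrderedTransTournament G m t →
           (j : ℕ) → 1 ≤ j → j < m →
           Good (extend G m t j)
lemma2p8 G (oriented , chordal , free) m t tr j _ _ =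
  extend-oriented oriented , extend-chordal chordal , extend-C3⇒K1-free oriented free
  where
  open Extension {G} {m} {t} tr j
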